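{- Let $n\in\mathbb{P}$, $n\ge 2$, and $I\subseteq[2,n-1]$. Then \[\sum_{\sigma\in D_n^{I\cup\{0\}}} y^{\ell(\sigma)}x^{L(\sigma)}=\sum_{\sigma\in D_n^{I\cup\{1\}}} y^{\ell(\sigma)}x^{L(\sigma)}.\] In particular $\sum_{\sigma\in D_n^{I\cup\{0\}}} (-1)^{\ell(\sigma)}x^{L(\sigma)}=\sum_{\sigma\in D_n^{I\cup\{1\}}} (-1)^{\ell(\sigma)}x^{L(\sigma)}$.
   Context: $\mathbb{P}=\{1,2,\dots\}$, $[m,n]=\{m,\dots,n\}$, $[n]=[1,n]$. $B_n$ is the group of bijections $\sigma$ of $[-n,n]$ with $\sigma(-j)=-\sigma(j)$, written in window notation $[\sigma(1),\dots,\sigma(n)]$; $D_n$ is the subgroup of those with an even number of negative entries among $\sigma(1),\dots,\sigma(n)$. For $\sigma\in D_n$: $\ell(\sigma)=\mathrm{inv}(\sigma)+\mathrm{nsp}(\sigma)$, where $\mathrm{inv}(\sigma)=|\{(i,j)\in[n]^2:i<j,\sigma(i)>\sigma(j)\}|$ and $\mathrm{nsp}(\sigma)=|\{(i,j)\in[n]^2:i<j,\sigma(i)+\sigma(j)<0\}|$; $L(\sigma)=\mathrm{oinv}(\sigma)+\mathrm{onsp}(\sigma)$, where $\mathrm{oinv}(\sigma)=|\{(i,j)\in[n]^2:i<j,\sigma(i)>\sigma(j),i\not\equiv j\pmod 2\}|$ and $\mathrm{onsp}(\sigma)=|\{(i,j)\in[n]^2:\sigma(i)+\sigma(j)<0,i\not\equiv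 j\pmod 2\}|$. For $J\subseteq[0,n-1]$, $D_n^J=\{\sigma\in D_n:\sigma(i)<\sigma(i+1)\ \forall i\in J\}$ with the convention $\sigma(0):=-\sigma(2)$. -}

module Defs where

open import Data.Bool using (Bool; true; false; _∧_; _∨_; not; if_then_else_; T)
open import Data.Nat as ℕ using (ℕ; zero; suc; _∸_)
open import Data.Integer as ℤ using (ℤ; +_; -_; ∣_∣)
open import Data.List using (List; []; _∷_; map; filter; length; concatMap; foldr; upTo)
open import Data.Fin using (Fin)
open import Relation.Nullary.Decidable using (⌊_⌋)
open import Algebra.Bundles using (CommutativeRing)
open import Level using (Level)

allᵇ : {A : Set} → (A → Bool) → List A → Bool
allᵇ p = foldr (λ x b → p x ∧ b) true

anyᵇ : {A : Set} → (A → Bool) → List A → Bool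
anyᵇ p = foldr (λ x b → p x ∨ b) false

infix 4 _<ᵇ_ _≡ℕᵇ_

_<ᵇ_ : ℤ → ℤ → Bool
a <ᵇ b = ⌊ a ℤ.<? b ⌋

_≡ℕᵇ_ : ℕ → ℕ → Bool
a ≡ℕᵇ b = ⌊ a ℕ.≟ b ⌋

odd : ℕ → Bool
odd zero = false
odd (suc k) = not (odd k)

diffParity : ℕ → ℕ → Bool
diffParity i j = not (odd i ≡ᵇ odd j)
  where
  _≡ᵇ_ : Bool → Bool → Bool
  true ≡ᵇ b = b
  false ≡ᵇ b = not b

range1 : ℕ → List ℕ
range1 n = map suc (upTo n)

-- A window [σ(1),…,σ(n)] is a list of integers.
-- σ(i) for i ∈ [1,n]; at(w, i) = i-th entry (1-based), 0 outside.
at : List ℤ → ℕ → ℤ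
at [] _ = + 0
at (x ∷ w) zero = + 0
at (x ∷ w) (suc zero) = x
at (x ∷ w) (suc (suc i)) = at w (suc i)

boxEntries : ℕ → List ℤ
boxEntries n = map (λ k → + k) (upTo (suc n)) Data.List.++ map (λ k → - (+ suc k)) (upTo n)

allWindows : ℕ → ℕ → List (List ℤ)
allWindows n zero = [] ∷ []
allWindows n (suc k) = concatMap (λ x → map (x ∷_) (allWindows n k)) (boxEntries n)

negCount : List ℤ → ℕ
negCount w = length (filter (λ x → x ℤ.<? + 0) w)

-- w is the window of an element of B_n: length n, entries with |σ(i)| ∈ [1,n],
-- and |σ(i)| pairwise distinct (so i ↦ σ(i) extends to a bijection of [-n,n]
-- with σ(-j) = -σ(j)).
isBn : ℕ → List ℤ → Bool
isBn n w =
  (length w ≡ℕᵇ n) ∧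
  allᵇ (λ i → ⌊ 1 ℕ.≤? ∣ at w i ∣ ⌋ ∧ ⌊ ∣ at w i ∣ ℕ.≤? n ⌋) (range1 n) ∧
  allᵇ (λ i → allᵇ (λ j → (i ≡ℕᵇ j) ∨ not (∣ at w i ∣ ≡ℕᵇ ∣ at w j ∣)) (range1 n)) (range1 n)

isDn : ℕ → List ℤ → Bool
isDn n w = isBn n w ∧ not (odd (negCount w))

Dn : ℕ → List (List ℤ)
Dn n = filter (λ w → T? (isDn n w)) (allWindows n n)
  where
  open import Relation.Nullary using (Dec; yes; no)
  open import Data.Unit using (tt)
  T? : (b : Bool) → Dec (T b)
  T? true = yes tt
  T? false = no (λ ())

countᵇ : {A : Set} → (A → Bool) → List A → ℕ
countᵇ p [] = 0
countᵇ p (x ∷ xs) = if p x then suc (countᵇ p xs) else countᵇ p xs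

countPairs : ℕ → (ℕ → ℕ → Bool) → ℕ
countPairs n p = foldr ℕ._+_ 0 (map (λ i → countᵇ (p i) (range1 n)) (range1 n))

inv : ℕ → List ℤ → ℕ
inv n w = countPairs n (λ i j → ⌊ i ℕ.<? j ⌋ ∧ (at w j <ᵇ at w i))

nsp : ℕ → List ℤ → ℕ
nsp n w = countPairs n (λ i j → ⌊ i ℕ.<? j ⌋ ∧ ((at w i ℤ.+ at w j) <ᵇ + 0))

oinv : ℕ → List ℤ → ℕ
oinv n w = countPairs n (λ i j → ⌊ i ℕ.<? j ⌋ ∧ (at w j <ᵇ at w i) ∧ diffParity i j)

onsp : ℕ → List ℤ → ℕ
onsp n w = countPairs n (λ i j → ⌊ i ℕ.<? j ⌋ ∧ ((at w i ℤ.+ at w j) <ᵇ + 0) ∧ diffParity i j)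

ℓ : ℕ → List ℤ → ℕ
ℓ n w = inv n w ℕ.+ nsp n w

L : ℕ → List ℤ → ℕ
L n w = oinv n w ℕ.+ onsp n w

-- σ(i) with the convention σ(0) := -σ(2)
atJ : List ℤ → ℕ → ℤ
atJ w zero = - at w 2
atJ w (suc i) = at w (suc i)

_∈ᵇ_ : ℕ → List ℕ → Bool
i ∈ᵇ J = anyᵇ (λ j → i ≡ℕᵇ j) J

-- D_n^J, J ⊆ [0,n-1] given as a list: σ(i) < σ(i+1) for all i ∈ J
inDnJ : ℕ → List ℕ → List ℤ → Bool
inDnJ n J w = allᵇ (λ i → atJ w i <ᵇ atJ w (suc i)) J

DnJ : ℕ → List ℕ → List (List ℤ)
DnJ n J = filter (λ w → T? (inDnJ n J w)) (Dn n)
  where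
  open import Relation.Nullary using (Dec; yes; no)
  open import Data.Unit using (tt)
  T? : (b : Bool) → Dec (T b)
  T? true = yes tt
  T? false = no (λ ())

genSum : ∀ {c r} (R : CommutativeRing c r) → ℕ → List ℕ →
         CommutativeRing.Carrier R → CommutativeRing.Carrier R → CommutativeRing.Carrier R
genSum R n J x y = foldr _+_ 0# (map (λ w → (y ^ ℓ n w) * (x ^ L n w)) (DnJ n J))
  where
  open CommutativeRing R
  open import Algebra.Properties.Monoid.Mult *-monoid using () renaming (_×_ to _^'_)
  _^_ : Carrier → ℕ → Carrier
  a ^ k = k ^' a

module Submission where

-- The proof is bijective.  Let flipOne exchange
-- the values 1 and -1, and let  twist σ = [-flipOne σ(1), flipOne σ(2), …, flipOne σ(n)].
--   * twist is a bijection of the set of all windows with entries in [-n, n]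
--     (∑-twist), so a sum of a function of twist w over all windows equals its sum over w.
--   * twist keeps B_n (absolute values are unchanged) and, on B_n, the parity of the
--     number of negative entries: flipOne changes the sign of the unique entry of absolute
--     value 1 and the head negation changes one more sign (isDn-twist).
--   * 1 and -1 are adjacent among nonzero values, so flipOne preserves comparisons of
--     entries of distinct absolute value; for pairs (1, j) the head negation exchanges the
--     inversion and negative-sum tests.  So every pair contributes the same to ℓ and L.
--   * The descent -σ(2) < σ(1) at 0 becomes the descent at 1 of twist σ; descents at
--     positions in [2, n-1] are unchanged (inDnJ-twist).

open import Defs
open import Data.Nat using (ℕ; _≤_; _∸_)
open import Data.List using (List; _∷_)
open import Data.List.Relation.Unary.All using (All)
open import Data.Product using (_×_)
open import Algebra.Bundles using (CommutativeRing)
open import Level using (Level)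

open import Data.Bool using (Bool; true; false; not; _∧_; _∨_; _xor_; if_then_else_; T)
open import Data.Bool.Properties using (∧-identityʳ; ∧-zeroʳ; not-involutive; not-distribˡ-xor; T-≡; T-not-≡; T-∧; xor-∧-commutativeRing)
open import Algebra.Properties.CommutativeSemigroup (CommutativeRing.+-commutativeSemigroup xor-∧-commutativeRing)
  using () renaming (interchange to xor-interchange)
open import Data.Nat as ℕ using (zero; suc; _<_; z≤n; s≤s)
import Data.Nat.Properties as ℕP
open import Data.Nat.ListAction using (sum)
open import Data.Integer as ℤ using (ℤ; +_; -[1+_]; -_; ∣_∣)
import Data.Integer.Properties as ℤP
open import Data.List using ([]; map; foldr; length; filter; concatMap; applyUpTo; upTo; _++_)
open import Data.List.Properties using (length-map; map-cong-local)
open import Data.List.Membership.Propositional using (_∈_; find; lose)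
open import Data.List.Membership.Propositional.Properties using (∈-map⁺; ∈-map⁻; ∈-upTo⁺; ∈-upTo⁻)
open import Data.List.Relation.Unary.Any using (here; there; any?)
import Data.List.Relation.Unary.All as All
open import Data.Fin using (Fin; toℕ; fromℕ<)
import Data.Fin.Properties as FinP
open import Data.Product using (∃; _,_; proj₁; proj₂)
open import Data.Empty using (⊥; ⊥-elim)
open import Function using (_∘_; Equivalence)
open import Function.Bundles using (mk⇔)
open import Relation.Nullary using (Dec; yes; no; does)
open import Relation.Nullary.Decidable using (⌊_⌋; isYes≗does; does-⇔; does-≡; toWitness; fromWitness; fromWitnessFalse)
open import Relation.Nullary.Decidable.Core using (T?)
open import Relation.Unary using (Decidable)
open import Relation.Binary.PropositionalEquality using (_≡_; _≢_; refl; sym; trans; cong; cong₂; subst; subst₂; module ≡-Reasoning)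

ind : Bool → ℕ
ind true = 1
ind false = 0

isYes-⇔ : {A B : Set} → (A → B) → (B → A) → (a? : Dec A) (b? : Dec B) → ⌊ a? ⌋ ≡ ⌊ b? ⌋
isYes-⇔ to from a? b? =
  trans (isYes≗does a?) (trans (does-⇔ (mk⇔ to from) a? b?) (sym (isYes≗does b?)))

if-cong-guarded : ∀ {a} {A : Set a} b {u v z : A} → (b ≡ true → u ≡ v) →
  (if b then u else z) ≡ (if b then v else z)
if-cong-guarded true u≡v = u≡v refl
if-cong-guarded false _ = refl

does-T : (b : Bool) (b? : Dec (T b)) → does b? ≡ b
does-T b b? = does-≡ b? (T? b)

<ᵇ-⇔ : {a b c d : ℤ} → (a ℤ.< b → c ℤ.< d) → (c ℤ.< d → a ℤ.< b) → (a <ᵇ b) ≡ (c <ᵇ d)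
<ᵇ-⇔ to from = isYes-⇔ to from (_ ℤ.<? _) (_ ℤ.<? _)

<-neg⇔sum : ∀ x y → (y <ᵇ - x) ≡ (x ℤ.+ y <ᵇ + 0)
<-neg⇔sum x y = <ᵇ-⇔ to from
  where
  to : y ℤ.< - x → x ℤ.+ y ℤ.< + 0
  to y<-x = subst (x ℤ.+ y ℤ.<_) (ℤP.+-inverseʳ x) (ℤP.+-monoʳ-< x y<-x)
  cancel : - x ℤ.+ (x ℤ.+ y) ≡ y
  cancel = trans (sym (ℤP.+-assoc (- x) x y))
                 (trans (cong (ℤ._+ y) (ℤP.+-inverseˡ x)) (ℤP.+-identityˡ y))
  from : x ℤ.+ y ℤ.< + 0 → y ℤ.< - x
  from x+y<0 = subst₂ ℤ._<_ cancel (ℤP.+-identityʳ (- x)) (ℤP.+-monoʳ-< (- x) x+y<0)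

neg-<-swap : ∀ a b → (- a <ᵇ b) ≡ (- b <ᵇ a)
neg-<-swap a b = <ᵇ-⇔ (swap a b) (swap b a)
  where
  swap : ∀ a b → - a ℤ.< b → - b ℤ.< a
  swap a b -a<b = subst (- b ℤ.<_) (ℤP.neg-involutive a) (ℤP.neg-mono-< -a<b)

neg-sign : ∀ a → a ≢ + 0 → (- a <ᵇ + 0) ≡ not (a <ᵇ + 0)
neg-sign (+ zero) a≢0 = ⊥-elim (a≢0 refl)
neg-sign (+ suc k) _ = refl
neg-sign -[1+ k ] _ = refl

Separated : ℤ → ℤ → Set
Separated a b = a ≢ + 0 × b ≢ + 0 × ∣ a ∣ ≢ ∣ b ∣

separated-swap : ∀ {a b} → Separated a b → Separated b a
separated-swap (a≢0 , b≢0 , ∣a∣≢∣b∣) = b≢0 , a≢0 , ∣a∣≢∣b∣ ∘ sym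

separated-negˡ : ∀ {a b} → Separated a b → Separated (- a) b
separated-negˡ {a} (a≢0 , b≢0 , ∣a∣≢∣b∣) =
  (λ -a≡0 → a≢0 (trans (sym (ℤP.neg-involutive a)) (cong -_ -a≡0))) , b≢0 ,
  (λ e → ∣a∣≢∣b∣ (trans (sym (ℤP.∣-i∣≡∣i∣ a)) e))

flipOne : ℤ → ℤ
flipOne (+ 1) = -[1+ 0 ]
flipOne -[1+ 0 ] = + 1
flipOne a = a

flipOne-abs : ∀ a → ∣ flipOne a ∣ ≡ ∣ a ∣
flipOne-abs (+ zero) = refl
flipOne-abs (+ 1) = refl
flipOne-abs (+ suc (suc k)) = refl
flipOne-abs -[1+ zero ] = refl
flipOne-abs -[1+ suc k ] = refl

flipOne-odd : ∀ a → flipOne (- a) ≡ - flipOne a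
flipOne-odd (+ zero) = refl
flipOne-odd (+ 1) = refl
flipOne-odd (+ suc (suc k)) = refl
flipOne-odd -[1+ zero ] = refl
flipOne-odd -[1+ suc k ] = refl

-- 1 and -1 are adjacent among the nonzero integers, so exchanging them preserves the
-- order of any two nonzero integers of distinct absolute value (a finite case check).
flipOne-mono : ∀ a b → Separated a b → (flipOne a <ᵇ flipOne b) ≡ (a <ᵇ b)
flipOne-mono (+ zero) b (a≢0 , _) = ⊥-elim (a≢0 refl)
flipOne-mono a (+ zero) (_ , b≢0 , _) = ⊥-elim (b≢0 refl)
flipOne-mono (+ 1) (+ 1) (_ , _ , d) = ⊥-elim (d refl)
flipOne-mono (+ 1) -[1+ 0 ] (_ , _ , d) = ⊥-elim (d refl)
flipOne-mono -[1+ 0 ] (+ 1) (_ , _ , d) = ⊥-elim (d refl)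
flipOne-mono -[1+ 0 ] -[1+ 0 ] (_ , _ , d) = ⊥-elim (d refl)
flipOne-mono (+ 1) (+ suc (suc k)) _ = refl
flipOne-mono (+ 1) -[1+ suc k ] _ = refl
flipOne-mono -[1+ 0 ] (+ suc (suc k)) _ = refl
flipOne-mono -[1+ 0 ] -[1+ suc k ] _ = refl
flipOne-mono (+ suc (suc k)) (+ 1) _ = refl
flipOne-mono -[1+ suc k ] (+ 1) _ = refl
flipOne-mono (+ suc (suc k)) -[1+ 0 ] _ = refl
flipOne-mono -[1+ suc k ] -[1+ 0 ] _ = refl
flipOne-mono (+ suc (suc k)) (+ suc (suc j)) _ = refl
flipOne-mono (+ suc (suc k)) -[1+ suc j ] _ = refl
flipOne-mono -[1+ suc k ] (+ suc (suc j)) _ = refl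
flipOne-mono -[1+ suc k ] -[1+ suc j ] _ = refl

isUnit : ℤ → Bool
isUnit a = ∣ a ∣ ≡ℕᵇ 1

isUnit-true : ∀ {a} → ∣ a ∣ ≡ 1 → isUnit a ≡ true
isUnit-true ∣a∣≡1 = Equivalence.to T-≡ (fromWitness ∣a∣≡1)

isUnit-false : ∀ {a} → ∣ a ∣ ≢ 1 → isUnit a ≡ false
isUnit-false ∣a∣≢1 = Equivalence.to T-not-≡ (fromWitnessFalse ∣a∣≢1)

flipOne-sign : ∀ a → (flipOne a <ᵇ + 0) ≡ isUnit a xor (a <ᵇ + 0)
flipOne-sign (+ zero) = refl
flipOne-sign (+ 1) = refl
flipOne-sign (+ suc (suc k)) = refl
flipOne-sign -[1+ zero ] = refl
flipOne-sign -[1+ suc k ] = refl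

-- The contribution [b < a] + [a + b < 0] of a pair of positions i < j with σ(i) = a and
-- σ(j) = b to ℓ = inv + nsp.
pairStat : ℤ → ℤ → ℕ
pairStat a b = ind (b <ᵇ a) ℕ.+ ind (a ℤ.+ b <ᵇ + 0)

flipOne-sum : ∀ a b → Separated a b → (flipOne a ℤ.+ flipOne b <ᵇ + 0) ≡ (a ℤ.+ b <ᵇ + 0)
flipOne-sum a b sep = begin
  flipOne a ℤ.+ flipOne b <ᵇ + 0  ≡⟨ sym (<-neg⇔sum (flipOne a) (flipOne b)) ⟩
  flipOne b <ᵇ - flipOne a        ≡⟨ cong (flipOne b <ᵇ_) (sym (flipOne-odd a)) ⟩
  flipOne b <ᵇ flipOne (- a)      ≡⟨ flipOne-mono b (- a) (separated-swap (separated-negˡ sep)) ⟩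
  b <ᵇ - a                        ≡⟨ <-neg⇔sum a b ⟩
  a ℤ.+ b <ᵇ + 0                  ∎
  where open ≡-Reasoning

pairStat-flipOne : ∀ a b → Separated a b → pairStat (flipOne a) (flipOne b) ≡ pairStat a b
pairStat-flipOne a b sep =
  cong₂ ℕ._+_ (cong ind (flipOne-mono b a (separated-swap sep))) (cong ind (flipOne-sum a b sep))

-- If moreover the first entry is negated, the two tests exchange their roles.
pairStat-twisted : ∀ a b → Separated a b → pairStat (- flipOne a) (flipOne b) ≡ pairStat a b
pairStat-twisted a b sep = begin
  ind (flipOne b <ᵇ - flipOne a) ℕ.+ ind (- flipOne a ℤ.+ flipOne b <ᵇ + 0)
    ≡⟨ cong₂ (λ s t → ind s ℕ.+ ind t) inversion-becomes-sum sum-becomes-inversion ⟩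
  ind (a ℤ.+ b <ᵇ + 0) ℕ.+ ind (b <ᵇ a)
    ≡⟨ ℕP.+-comm (ind (a ℤ.+ b <ᵇ + 0)) (ind (b <ᵇ a)) ⟩
  pairStat a b ∎
  where
  open ≡-Reasoning
  inversion-becomes-sum : (flipOne b <ᵇ - flipOne a) ≡ (a ℤ.+ b <ᵇ + 0)
  inversion-becomes-sum = trans (<-neg⇔sum (flipOne a) (flipOne b)) (flipOne-sum a b sep)
  sum-becomes-inversion : (- flipOne a ℤ.+ flipOne b <ᵇ + 0) ≡ (b <ᵇ a)
  sum-becomes-inversion =
    trans (sym (<-neg⇔sum (- flipOne a) (flipOne b)))
          (trans (cong (flipOne b <ᵇ_) (ℤP.neg-involutive (flipOne a)))
                 (flipOne-mono b a (separated-swap sep)))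

-- The descent test at 1 for the twisted pair is the test σ(0) < σ(1), σ(0) = -σ(2).
descent-twisted : ∀ a b → Separated a b → (- flipOne a <ᵇ flipOne b) ≡ (- b <ᵇ a)
descent-twisted a b sep = begin
  - flipOne a <ᵇ flipOne b        ≡⟨ cong (_<ᵇ flipOne b) (sym (flipOne-odd a)) ⟩
  flipOne (- a) <ᵇ flipOne b      ≡⟨ flipOne-mono (- a) b (separated-negˡ sep) ⟩
  - a <ᵇ b                        ≡⟨ neg-<-swap a b ⟩
  - b <ᵇ a                        ∎
  where open ≡-Reasoning

onHead : (ℤ → ℤ) → List ℤ → List ℤ
onHead f [] = []
onHead f (a ∷ w) = f a ∷ w

twist : List ℤ → List ℤ
twist w = onHead -_ (map flipOne w)

twistAt : ℕ → ℤ → ℤ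
twistAt (suc zero) a = - flipOne a
twistAt _ a = flipOne a

at-map : ∀ (f : ℤ → ℤ) → f (+ 0) ≡ + 0 → ∀ w i → at (map f w) i ≡ f (at w i)
at-map f f0 [] i = sym f0
at-map f f0 (a ∷ w) zero = sym f0
at-map f f0 (a ∷ w) (suc zero) = refl
at-map f f0 (a ∷ w) (suc (suc i)) = at-map f f0 w (suc i)

at-twist : ∀ w i → at (twist w) i ≡ twistAt i (at w i)
at-twist [] zero = refl
at-twist [] (suc zero) = refl
at-twist [] (suc (suc i)) = refl
at-twist (a ∷ w) zero = refl
at-twist (a ∷ w) (suc zero) = refl
at-twist (a ∷ w) (suc (suc i)) = at-map flipOne refl w (suc i)

abs-twistAt : ∀ i a → ∣ twistAt i a ∣ ≡ ∣ a ∣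
abs-twistAt zero a = flipOne-abs a
abs-twistAt (suc zero) a = trans (ℤP.∣-i∣≡∣i∣ (flipOne a)) (flipOne-abs a)
abs-twistAt (suc (suc i)) a = flipOne-abs a

abs-at-twist : ∀ w i → ∣ at (twist w) i ∣ ≡ ∣ at w i ∣
abs-at-twist w i = trans (cong ∣_∣ (at-twist w i)) (abs-twistAt i (at w i))

length-twist : ∀ w → length (twist w) ≡ length w
length-twist [] = refl
length-twist (a ∷ w) = cong suc (length-map flipOne w)

allᵇ-cong : {A : Set} {p q : A → Bool} (xs : List A) → (∀ {x} → x ∈ xs → p x ≡ q x) →
  allᵇ p xs ≡ allᵇ q xs
allᵇ-cong [] _ = refl
allᵇ-cong (x ∷ xs) p≗q = cong₂ _∧_ (p≗q (here refl)) (allᵇ-cong xs (p≗q ∘ there))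

-- Membership in B_n only depends on the length and the absolute values of the entries.
isBn-twist : ∀ n w → isBn n (twist w) ≡ isBn n w
isBn-twist n w =
  cong₂ _∧_ (cong (_≡ℕᵇ n) (length-twist w)) (cong₂ _∧_
    (allᵇ-cong (range1 n) (λ {i} _ → cong (λ v → ⌊ 1 ℕ.≤? v ⌋ ∧ ⌊ v ℕ.≤? n ⌋) (abs-at-twist w i)))
    (allᵇ-cong (range1 n) (λ {i} _ → allᵇ-cong (range1 n) (λ {j} _ →
      cong₂ (λ u v → (i ≡ℕᵇ j) ∨ not (u ≡ℕᵇ v)) (abs-at-twist w i) (abs-at-twist w j)))))

range1⁺ : ∀ {n i} → 1 ≤ i → i ≤ n → i ∈ range1 n
range1⁺ {i = suc k} (s≤s z≤n) i≤n = ∈-map⁺ suc (∈-upTo⁺ i≤n)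

range1⁻ : ∀ {n i} → i ∈ range1 n → 1 ≤ i × i ≤ n
range1⁻ i∈ with ∈-map⁻ suc i∈
... | k , k∈ , refl = s≤s z≤n , ∈-upTo⁻ k∈

T-∧-split : ∀ x y → T (x ∧ y) → T x × T y
T-∧-split x y = Equivalence.to (T-∧ {x} {y})

allᵇ-sound : {A : Set} (p : A → Bool) (xs : List A) → T (allᵇ p xs) → ∀ {x} → x ∈ xs → T (p x)
allᵇ-sound p (y ∷ xs) h (here refl) = proj₁ (T-∧-split (p y) (allᵇ p xs) h)
allᵇ-sound p (y ∷ xs) h (there x∈) = allᵇ-sound p xs (proj₂ (T-∧-split (p y) (allᵇ p xs) h)) x∈

record SignedPermutation (n : ℕ) (w : List ℤ) : Set where
  field
    length≡ : length w ≡ n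
    abs-bounds : ∀ {i} → i ∈ range1 n → 1 ≤ ∣ at w i ∣ × ∣ at w i ∣ ≤ n
    abs-injective : ∀ {i j} → i ∈ range1 n → j ∈ range1 n → i ≢ j → ∣ at w i ∣ ≢ ∣ at w j ∣

  entry≢0 : ∀ {i} → i ∈ range1 n → at w i ≢ + 0
  entry≢0 i∈ at≡0 = ℕP.<⇒≢ (proj₁ (abs-bounds i∈)) (sym (cong ∣_∣ at≡0))

  separated : ∀ {i j} → i ∈ range1 n → j ∈ range1 n → i ≢ j → Separated (at w i) (at w j)
  separated i∈ j∈ i≢j = entry≢0 i∈ , entry≢0 j∈ , abs-injective i∈ j∈ i≢j

signedPermutation : ∀ n w → isBn n w ≡ true → SignedPermutation n w
signedPermutation n w isBn≡true = record
  { length≡ = toWitness {a? = length w ℕ.≟ n} length-ok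
  ; abs-bounds = bounds
  ; abs-injective = injective
  }
  where
  inRange : ℕ → Bool
  inRange i = ⌊ 1 ℕ.≤? ∣ at w i ∣ ⌋ ∧ ⌊ ∣ at w i ∣ ℕ.≤? n ⌋
  distinctFrom : ℕ → ℕ → Bool
  distinctFrom i j = (i ≡ℕᵇ j) ∨ not (∣ at w i ∣ ≡ℕᵇ ∣ at w j ∣)
  ranges : Bool
  ranges = allᵇ inRange (range1 n)
  distinct : Bool
  distinct = allᵇ (λ i → allᵇ (distinctFrom i) (range1 n)) (range1 n)
  isBn-T : T ((length w ≡ℕᵇ n) ∧ ranges ∧ distinct)
  isBn-T = Equivalence.from T-≡ isBn≡true
  length-ok : T (length w ≡ℕᵇ n)
  length-ok = proj₁ (T-∧-split (length w ≡ℕᵇ n) (ranges ∧ distinct) isBn-T)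
  rest : T ranges × T distinct
  rest = T-∧-split ranges distinct (proj₂ (T-∧-split (length w ≡ℕᵇ n) (ranges ∧ distinct) isBn-T))

  bounds : ∀ {i} → i ∈ range1 n → 1 ≤ ∣ at w i ∣ × ∣ at w i ∣ ≤ n
  bounds {i} i∈ with T-∧-split _ _ (allᵇ-sound inRange (range1 n) (proj₁ rest) i∈)
  ... | lo , hi = toWitness {a? = 1 ℕ.≤? ∣ at w i ∣} lo , toWitness {a? = ∣ at w i ∣ ℕ.≤? n} hi

  distinctness : ∀ i j → T (distinctFrom i j) → i ≢ j → ∣ at w i ∣ ≢ ∣ at w j ∣
  distinctness i j h i≢j same with i ℕ.≟ j | ∣ at w i ∣ ℕ.≟ ∣ at w j ∣
  ... | yes i≡j | _ = i≢j i≡j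
  ... | no _ | yes _ = h
  ... | no _ | no different = different same

  injective : ∀ {i j} → i ∈ range1 n → j ∈ range1 n → i ≢ j → ∣ at w i ∣ ≢ ∣ at w j ∣
  injective {i} {j} i∈ j∈ = distinctness i j
    (allᵇ-sound (distinctFrom i) (range1 n)
      (allᵇ-sound (λ i → allᵇ (distinctFrom i) (range1 n)) (range1 n) (proj₂ rest) i∈) j∈)

-- A signed-permutation window of positive length has an entry of absolute value 1:
-- otherwise its suc k absolute values would be distinct elements of [2, suc k].
unit-entry : ∀ {k w} → SignedPermutation (suc k) w → ∃ λ p → p ∈ range1 (suc k) × ∣ at w p ∣ ≡ 1
unit-entry {k} {w} σ with any? (λ i → ∣ at w i ∣ ℕ.≟ 1) (range1 (suc k))
... | yes found = find found
... | no none = ⊥-elim collision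
  where
  open SignedPermutation σ
  position : (i : Fin (suc k)) → suc (toℕ i) ∈ range1 (suc k)
  position i = range1⁺ (s≤s z≤n) (FinP.toℕ<n i)
  value : Fin (suc k) → ℕ
  value i = ∣ at w (suc (toℕ i)) ∣
  value≥2 : ∀ i → 2 ≤ value i
  value≥2 i = ℕP.≤∧≢⇒< (proj₁ (abs-bounds (position i))) (λ 1≡v → none (lose (position i) (sym 1≡v)))
  -- The absolute values, shifted down by 2, as an injection Fin (suc k) → Fin k.
  code : Fin (suc k) → Fin k
  code i = fromℕ< (ℕP.∸-monoˡ-< {value i} {2} {suc (suc k)} (s≤s (proj₂ (abs-bounds (position i)))) (value≥2 i))
  collision : ⊥
  collision with FinP.pigeonhole (ℕP.n<1+n k) code
  ... | i , j , i<j , same-code = abs-injective (position i) (position j)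
          (λ e → ℕP.<⇒≢ i<j (ℕP.suc-injective e))
          (ℕP.∸-cancelʳ-≡ (value≥2 i) (value≥2 j)
            (trans (sym (FinP.toℕ-fromℕ< _)) (trans (cong toℕ same-code) (FinP.toℕ-fromℕ< _))))

oddUnits : List ℤ → Bool
oddUnits [] = false
oddUnits (a ∷ w) = isUnit a xor oddUnits w

oddUnits-none : ∀ r → (∀ q → 1 ≤ q → q ≤ length r → ∣ at r q ∣ ≢ 1) → oddUnits r ≡ false
oddUnits-none [] _ = refl
oddUnits-none (a ∷ r) none = cong₂ _xor_ (isUnit-false {a} (none 1 (s≤s z≤n) (s≤s z≤n)))
  (oddUnits-none r (λ { (suc q) _ q≤ → none (suc (suc q)) (s≤s z≤n) (s≤s q≤) }))

oddUnits-one : ∀ r p → 1 ≤ p → p ≤ length r → ∣ at r p ∣ ≡ 1 →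
  (∀ q → 1 ≤ q → q ≤ length r → q ≢ p → ∣ at r q ∣ ≢ 1) → oddUnits r ≡ true
oddUnits-one (a ∷ r) (suc zero) _ _ unit others = cong₂ _xor_ (isUnit-true {a} unit)
  (oddUnits-none r (λ { (suc q) _ q≤ → others (suc (suc q)) (s≤s z≤n) (s≤s q≤) (λ ()) }))
oddUnits-one (a ∷ r) (suc (suc p)) _ (s≤s p≤) unit others =
  cong₂ _xor_ (isUnit-false {a} (others 1 (s≤s z≤n) (s≤s z≤n) (λ ())))
    (oddUnits-one r (suc p) (s≤s z≤n) p≤ unit
      (λ { (suc q) _ q≤ q≢p → others (suc (suc q)) (s≤s z≤n) (s≤s q≤) (q≢p ∘ ℕP.suc-injective) }))

oddUnits-window : ∀ {k w} → SignedPermutation (suc k) w → oddUnits w ≡ true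
oddUnits-window {k} {w} σ with unit-entry σ
... | p , p∈ , unit = oddUnits-one w p (proj₁ (range1⁻ p∈))
        (subst (p ≤_) (sym length≡) (proj₂ (range1⁻ p∈))) unit others
  where
  open SignedPermutation σ
  others : ∀ q → 1 ≤ q → q ≤ length w → q ≢ p → ∣ at w q ∣ ≢ 1
  others q 1≤q q≤ q≢p abs≡1 =
    abs-injective (range1⁺ 1≤q (subst (q ≤_) length≡ q≤)) p∈ q≢p (trans abs≡1 (sym unit))

negParity : List ℤ → Bool
negParity w = odd (negCount w)

negParity-∷ : ∀ a w → negParity (a ∷ w) ≡ (a <ᵇ + 0) xor negParity w
negParity-∷ a w with a ℤ.<? + 0
... | yes _ = refl
... | no _ = refl

negParity-flipOne : ∀ w → negParity (map flipOne w) ≡ oddUnits w xor negParity w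
negParity-flipOne [] = refl
negParity-flipOne (a ∷ w) = begin
  negParity (flipOne a ∷ map flipOne w)
    ≡⟨ negParity-∷ (flipOne a) (map flipOne w) ⟩
  (flipOne a <ᵇ + 0) xor negParity (map flipOne w)
    ≡⟨ cong₂ _xor_ (flipOne-sign a) (negParity-flipOne w) ⟩
  (isUnit a xor (a <ᵇ + 0)) xor (oddUnits w xor negParity w)
    ≡⟨ xor-interchange (isUnit a) (a <ᵇ + 0) (oddUnits w) (negParity w) ⟩
  (isUnit a xor oddUnits w) xor ((a <ᵇ + 0) xor negParity w)
    ≡⟨ cong ((isUnit a xor oddUnits w) xor_) (sym (negParity-∷ a w)) ⟩
  oddUnits (a ∷ w) xor negParity (a ∷ w) ∎
  where open ≡-Reasoning

negParity-negate : ∀ a w → a ≢ + 0 → negParity (- a ∷ w) ≡ not (negParity (a ∷ w))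
negParity-negate a w a≢0 = begin
  negParity (- a ∷ w)                 ≡⟨ negParity-∷ (- a) w ⟩
  (- a <ᵇ + 0) xor negParity w        ≡⟨ cong (_xor negParity w) (neg-sign a a≢0) ⟩
  not (a <ᵇ + 0) xor negParity w      ≡⟨ sym (not-distribˡ-xor (a <ᵇ + 0) (negParity w)) ⟩
  not ((a <ᵇ + 0) xor negParity w)    ≡⟨ cong not (sym (negParity-∷ a w)) ⟩
  not (negParity (a ∷ w))             ∎
  where open ≡-Reasoning

flipOne-≢0 : ∀ a → a ≢ + 0 → flipOne a ≢ + 0
flipOne-≢0 a a≢0 flip≡0 = a≢0 (ℤP.∣i∣≡0⇒i≡0 (trans (sym (flipOne-abs a)) (cong ∣_∣ flip≡0)))

-- On B_n the two sign changes made by twist cancel in parity.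
negParity-twist : ∀ {k w} → SignedPermutation (suc k) w → negParity (twist w) ≡ negParity w
negParity-twist {w = []} σ = ⊥-elim (ℕP.0≢1+n (SignedPermutation.length≡ σ))
negParity-twist {k} {a ∷ r} σ = begin
  negParity (- flipOne a ∷ map flipOne r)
    ≡⟨ negParity-negate (flipOne a) (map flipOne r) (flipOne-≢0 a (entry≢0 (range1⁺ (s≤s z≤n) (s≤s z≤n)))) ⟩
  not (negParity (map flipOne (a ∷ r)))
    ≡⟨ cong not (negParity-flipOne (a ∷ r)) ⟩
  not (oddUnits (a ∷ r) xor negParity (a ∷ r))
    ≡⟨ cong (λ u → not (u xor negParity (a ∷ r))) (oddUnits-window σ) ⟩
  not (not (negParity (a ∷ r)))
    ≡⟨ not-involutive (negParity (a ∷ r)) ⟩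
  negParity (a ∷ r) ∎
  where
  open ≡-Reasoning
  open SignedPermutation σ

∧-cong-guarded : ∀ b {x y} → (b ≡ true → x ≡ y) → b ∧ x ≡ b ∧ y
∧-cong-guarded true x≡y = x≡y refl
∧-cong-guarded false _ = refl

isDn-twist : ∀ k w → isDn (suc k) (twist w) ≡ isDn (suc k) w
isDn-twist k w =
  trans (cong (_∧ not (negParity (twist w))) (isBn-twist (suc k) w))
        (∧-cong-guarded (isBn (suc k) w)
          (λ isBn≡true → cong not (negParity-twist (signedPermutation (suc k) w isBn≡true))))

ind₂ : Bool → Bool → ℕ
ind₂ x y = ind x ℕ.+ ind y

countᵇ-as-sum : {A : Set} (p : A → Bool) (xs : List A) → countᵇ p xs ≡ sum (map (ind ∘ p) xs)
countᵇ-as-sum p [] = refl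
countᵇ-as-sum p (x ∷ xs) with p x
... | true = cong suc (countᵇ-as-sum p xs)
... | false = countᵇ-as-sum p xs

sum-map-+ : {A : Set} (f g : A → ℕ) (xs : List A) →
  sum (map f xs) ℕ.+ sum (map g xs) ≡ sum (map (λ x → f x ℕ.+ g x) xs)
sum-map-+ f g [] = refl
sum-map-+ f g (x ∷ xs) =
  trans (ℕ-interchange (f x) (sum (map f xs)) (g x) (sum (map g xs)))
        (cong (f x ℕ.+ g x ℕ.+_) (sum-map-+ f g xs))
  where
  open import Algebra.Properties.CommutativeSemigroup ℕP.+-commutativeSemigroup
    using () renaming (interchange to ℕ-interchange)

sum-map-cong : {A : Set} {f g : A → ℕ} (xs : List A) → (∀ {x} → x ∈ xs → f x ≡ g x) →
  sum (map f xs) ≡ sum (map g xs)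
sum-map-cong xs f≗g = cong sum (map-cong-local (All.tabulate f≗g))

countPairs-+ : ∀ n (p q : ℕ → ℕ → Bool) → countPairs n p ℕ.+ countPairs n q ≡
  sum (map (λ i → sum (map (λ j → ind₂ (p i j) (q i j)) (range1 n))) (range1 n))
countPairs-+ n p q =
  trans (sum-map-+ (λ i → countᵇ (p i) (range1 n)) (λ i → countᵇ (q i) (range1 n)) (range1 n))
        (sum-map-cong (range1 n) (λ {i} _ →
          trans (cong₂ ℕ._+_ (countᵇ-as-sum (p i) (range1 n)) (countᵇ-as-sum (q i) (range1 n)))
                (sum-map-+ (λ j → ind (p i j)) (λ j → ind (q i j)) (range1 n))))

countPairs-+-cong : ∀ n (p q p′ q′ : ℕ → ℕ → Bool) →
  (∀ {i j} → i ∈ range1 n → j ∈ range1 n → ind₂ (p′ i j) (q′ i j) ≡ ind₂ (p i j) (q i j)) →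
  countPairs n p′ ℕ.+ countPairs n q′ ≡ countPairs n p ℕ.+ countPairs n q
countPairs-+-cong n p q p′ q′ pointwise =
  trans (countPairs-+ n p′ q′)
        (trans (sum-map-cong (range1 n) (λ i∈ → sum-map-cong (range1 n) (λ j∈ → pointwise i∈ j∈)))
               (sym (countPairs-+ n p q)))

ind₂-guardˡ : ∀ c {x y x′ y′} → (c ≡ true → ind₂ x′ y′ ≡ ind₂ x y) →
  ind₂ (c ∧ x′) (c ∧ y′) ≡ ind₂ (c ∧ x) (c ∧ y)
ind₂-guardˡ true same = same refl
ind₂-guardˡ false _ = refl

ind₂-guardʳ : ∀ d x′ y′ x y → ind₂ x′ y′ ≡ ind₂ x y → ind₂ (x′ ∧ d) (y′ ∧ d) ≡ ind₂ (x ∧ d) (y ∧ d)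
ind₂-guardʳ true x′ y′ x y same =
  trans (cong₂ ind₂ (∧-identityʳ x′) (∧-identityʳ y′))
        (trans same (sym (cong₂ ind₂ (∧-identityʳ x) (∧-identityʳ y))))
ind₂-guardʳ false x′ y′ x y _ =
  trans (cong₂ ind₂ (∧-zeroʳ x′) (∧-zeroʳ y′)) (sym (cong₂ ind₂ (∧-zeroʳ x) (∧-zeroʳ y)))

isYes-sound : {A : Set} (a? : Dec A) → ⌊ a? ⌋ ≡ true → A
isYes-sound a? holds = toWitness {a? = a?} (Equivalence.from T-≡ holds)

pairStat-twistAt : ∀ i j a b → 1 ≤ i → i < j → Separated a b →
  pairStat (twistAt i a) (twistAt j b) ≡ pairStat a b
pairStat-twistAt (suc zero) (suc (suc j)) a b _ _ sep = pairStat-twisted a b sep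
pairStat-twistAt (suc (suc i)) (suc (suc (suc j))) a b _ _ sep = pairStat-flipOne a b sep
pairStat-twistAt (suc zero) (suc zero) a b _ (s≤s ()) sep
pairStat-twistAt (suc (suc i)) (suc (suc zero)) a b _ (s≤s (s≤s ())) sep
pairStat-twistAt (suc (suc i)) (suc zero) a b _ (s≤s ()) sep

pairStat-twist : ∀ {n w} → SignedPermutation n w → ∀ {i j} → i ∈ range1 n → j ∈ range1 n → i < j →
  pairStat (at (twist w) i) (at (twist w) j) ≡ pairStat (at w i) (at w j)
pairStat-twist {w = w} σ {i} {j} i∈ j∈ i<j =
  trans (cong₂ pairStat (at-twist w i) (at-twist w j))
        (pairStat-twistAt i j (at w i) (at w j) (proj₁ (range1⁻ i∈)) i<j (separated i∈ j∈ (ℕP.<⇒≢ i<j)))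
  where open SignedPermutation σ

inversion negativeSum : List ℤ → ℕ → ℕ → Bool
inversion w i j = ⌊ i ℕ.<? j ⌋ ∧ (at w j <ᵇ at w i)
negativeSum w i j = ⌊ i ℕ.<? j ⌋ ∧ ((at w i ℤ.+ at w j) <ᵇ + 0)

oddInversion oddNegativeSum : List ℤ → ℕ → ℕ → Bool
oddInversion w i j = ⌊ i ℕ.<? j ⌋ ∧ (at w j <ᵇ at w i) ∧ diffParity i j
oddNegativeSum w i j = ⌊ i ℕ.<? j ⌋ ∧ ((at w i ℤ.+ at w j) <ᵇ + 0) ∧ diffParity i j

ℓ-twist : ∀ {n w} → SignedPermutation n w → ℓ n (twist w) ≡ ℓ n w
ℓ-twist {n} {w} σ =
  countPairs-+-cong n (inversion w) (negativeSum w) (inversion (twist w)) (negativeSum (twist w))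
    (λ {i} {j} i∈ j∈ → ind₂-guardˡ ⌊ i ℕ.<? j ⌋
      (λ i<j → pairStat-twist σ i∈ j∈ (isYes-sound (i ℕ.<? j) i<j)))

L-twist : ∀ {n w} → SignedPermutation n w → L n (twist w) ≡ L n w
L-twist {n} {w} σ =
  countPairs-+-cong n (oddInversion w) (oddNegativeSum w) (oddInversion (twist w)) (oddNegativeSum (twist w))
    (λ {i} {j} i∈ j∈ → ind₂-guardˡ ⌊ i ℕ.<? j ⌋ (λ i<j →
      ind₂-guardʳ (diffParity i j) (at (twist w) j <ᵇ at (twist w) i) (at (twist w) i ℤ.+ at (twist w) j <ᵇ + 0)
                  (at w j <ᵇ at w i) (at w i ℤ.+ at w j <ᵇ + 0)
                  (pairStat-twist σ i∈ j∈ (isYes-sound (i ℕ.<? j) i<j))))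

descent₀-twist : ∀ {n w} → SignedPermutation n w → 2 ≤ n →
  (atJ (twist w) 1 <ᵇ atJ (twist w) 2) ≡ (atJ w 0 <ᵇ atJ w 1)
descent₀-twist {n} {w} σ 2≤n =
  trans (cong₂ _<ᵇ_ (at-twist w 1) (at-twist w 2))
        (descent-twisted (at w 1) (at w 2) (separated 1∈ 2∈ (λ ())))
  where
  open SignedPermutation σ
  1∈ : 1 ∈ range1 n
  1∈ = range1⁺ (s≤s z≤n) (ℕP.≤-trans (s≤s z≤n) 2≤n)
  2∈ : 2 ∈ range1 n
  2∈ = range1⁺ (s≤s z≤n) 2≤n

descent-twist : ∀ {n w} → SignedPermutation n w → ∀ i → 2 ≤ i → suc i ≤ n →
  (atJ (twist w) i <ᵇ atJ (twist w) (suc i)) ≡ (atJ w i <ᵇ atJ w (suc i))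
descent-twist {n} {w} σ (suc (suc k)) _ i+1≤n =
  trans (cong₂ _<ᵇ_ (at-twist w (suc (suc k))) (at-twist w (suc (suc (suc k)))))
        (flipOne-mono _ _ (separated i∈ i+1∈ (λ ())))
  where
  open SignedPermutation σ
  i+1∈ : suc (suc (suc k)) ∈ range1 n
  i+1∈ = range1⁺ (s≤s z≤n) i+1≤n
  i∈ : suc (suc k) ∈ range1 n
  i∈ = range1⁺ (s≤s z≤n) (ℕP.≤-trans (ℕP.n≤1+n _) i+1≤n)
descent-twist σ (suc zero) (s≤s ()) _

inDnJ-twist : ∀ k w → SignedPermutation (suc (suc k)) w →
  ∀ I → All (λ i → 2 ≤ i × i ≤ suc (suc k) ∸ 1) I →
  inDnJ (suc (suc k)) (1 ∷ I) (twist w) ≡ inDnJ (suc (suc k)) (0 ∷ I) w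
inDnJ-twist k w σ I I⊆ =
  cong₂ _∧_ (descent₀-twist σ (s≤s (s≤s z≤n)))
            (allᵇ-cong I (λ {i} i∈I → descent-twist σ i (proj₁ (All.lookup I⊆ i∈I)) (s≤s (proj₂ (All.lookup I⊆ i∈I)))))

isDn⇒signedPermutation : ∀ n w → isDn n w ≡ true → SignedPermutation n w
isDn⇒signedPermutation n w isDn≡true = signedPermutation n w
  (Equivalence.to T-≡ (proj₁ (T-∧-split (isBn n w) (not (negParity w)) (Equivalence.from T-≡ isDn≡true))))

module WindowSums {c r} (R : CommutativeRing c r) where
  open CommutativeRing R
    using (Carrier; _≈_; _+_; _*_; 0#; setoid; +-cong; +-congˡ; +-congʳ; +-assoc; +-comm; +-identityˡ;
           +-commutativeSemigroup; *-monoid)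
    renaming (refl to ≈-refl; sym to ≈-sym; trans to ≈-trans; reflexive to ≈-reflexive)
  open import Relation.Binary.Reasoning.Setoid setoid
  open import Algebra.Properties.CommutativeSemigroup +-commutativeSemigroup using (interchange; x∙yz≈y∙xz)
  open import Algebra.Properties.Monoid.Mult *-monoid using () renaming (_×_ to _times_)

  ∑ : {A : Set} → List A → (A → Carrier) → Carrier
  ∑ [] f = 0#
  ∑ (x ∷ xs) f = f x + ∑ xs f

  ∑-cong : {A : Set} (xs : List A) {f g : A → Carrier} → (∀ x → f x ≈ g x) → ∑ xs f ≈ ∑ xs g
  ∑-cong [] f≈g = ≈-refl
  ∑-cong (x ∷ xs) f≈g = +-cong (f≈g x) (∑-cong xs f≈g)

  ∑-++ : {A : Set} (xs ys : List A) (f : A → Carrier) → ∑ (xs ++ ys) f ≈ ∑ xs f + ∑ ys f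
  ∑-++ [] ys f = ≈-sym (+-identityˡ _)
  ∑-++ (x ∷ xs) ys f = ≈-trans (+-congˡ (∑-++ xs ys f)) (≈-sym (+-assoc _ _ _))

  ∑-map : {A B : Set} (xs : List A) (h : A → B) (f : B → Carrier) → ∑ (map h xs) f ≡ ∑ xs (f ∘ h)
  ∑-map [] h f = refl
  ∑-map (x ∷ xs) h f = cong (_+_ (f (h x))) (∑-map xs h f)

  ∑-concatMap : {A B : Set} (xs : List A) (h : A → List B) (f : B → Carrier) →
    ∑ (concatMap h xs) f ≈ ∑ xs (λ x → ∑ (h x) f)
  ∑-concatMap [] h f = ≈-refl
  ∑-concatMap (x ∷ xs) h f = ≈-trans (∑-++ (h x) (concatMap h xs) f) (+-congˡ (∑-concatMap xs h f))

  ∑-filter : {A : Set} {P : A → Set} (P? : Decidable P) (xs : List A) (f : A → Carrier) →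
    ∑ (filter P? xs) f ≈ ∑ xs (λ x → if does (P? x) then f x else 0#)
  ∑-filter P? [] f = ≈-refl
  ∑-filter P? (x ∷ xs) f with does (P? x)
  ... | true = +-congˡ (∑-filter P? xs f)
  ... | false = ≈-trans (∑-filter P? xs f) (≈-sym (+-identityˡ _))

  ∑-filter-T : {A : Set} (p q : A → Bool) (p? : ∀ x → Dec (T (p x))) (q? : ∀ x → Dec (T (q x)))
    (xs : List A) (f : A → Carrier) →
    ∑ (filter q? (filter p? xs)) f ≈ ∑ xs (λ x → if p x then (if q x then f x else 0#) else 0#)
  ∑-filter-T p q p? q? xs f =
    ≈-trans (∑-filter q? (filter p? xs) f)
      (≈-trans (∑-filter p? xs (λ x → if does (q? x) then f x else 0#))
        (∑-cong xs (λ x → ≈-reflexive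
          (cong₂ (λ b b′ → if b then (if b′ then f x else 0#) else 0#) (does-T (p x) (p? x)) (does-T (q x) (q? x))))))

  foldr-as-∑ : {A : Set} (xs : List A) (f : A → Carrier) → foldr _+_ 0# (map f xs) ≡ ∑ xs f
  foldr-as-∑ [] f = refl
  foldr-as-∑ (x ∷ xs) f = cong (_+_ (f x)) (foldr-as-∑ xs f)

  ∑< : ℕ → (ℕ → Carrier) → Carrier
  ∑< zero F = 0#
  ∑< (suc n) F = F 0 + ∑< n (F ∘ suc)

  ∑-applyUpTo : {A : Set} (f : ℕ → A) (n : ℕ) (h : A → Carrier) → ∑ (applyUpTo f n) h ≡ ∑< n (h ∘ f)
  ∑-applyUpTo f zero h = refl
  ∑-applyUpTo f (suc n) h = cong (_+_ (h (f 0))) (∑-applyUpTo (f ∘ suc) n h)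

  ∑-box : ∀ n (h : ℤ → Carrier) →
    ∑ (boxEntries n) h ≈ (h (+ 0) + ∑< n (λ k → h (+ suc k))) + ∑< n (λ k → h -[1+ k ])
  ∑-box n h = begin
    ∑ (boxEntries n) h
      ≈⟨ ∑-++ (map (λ k → + k) (upTo (suc n))) (map (λ k → - (+ suc k)) (upTo n)) h ⟩
    ∑ (map (λ k → + k) (upTo (suc n))) h + ∑ (map (λ k → - (+ suc k)) (upTo n)) h
      ≡⟨ cong₂ _+_ (trans (∑-map (upTo (suc n)) (λ k → + k) h) (∑-applyUpTo (λ k → k) (suc n) (λ k → h (+ k))))
                   (trans (∑-map (upTo n) (λ k → - (+ suc k)) h) (∑-applyUpTo (λ k → k) n _)) ⟩
    (h (+ 0) + ∑< n (λ k → h (+ suc k))) + ∑< n (λ k → h -[1+ k ]) ∎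

  BoxSymmetry : ℕ → (ℤ → ℤ) → Set (c Level.⊔ r)
  BoxSymmetry n φ = ∀ h → ∑ (boxEntries n) (h ∘ φ) ≈ ∑ (boxEntries n) h

  box-neg : ∀ n → BoxSymmetry n -_
  box-neg n h = begin
    ∑ (boxEntries n) (h ∘ -_)                                        ≈⟨ ∑-box n (h ∘ -_) ⟩
    (h (+ 0) + ∑< n (λ k → h -[1+ k ])) + ∑< n (λ k → h (+ suc k))   ≈⟨ xy∙z≈xz∙y _ _ _ ⟩
    (h (+ 0) + ∑< n (λ k → h (+ suc k))) + ∑< n (λ k → h -[1+ k ])   ≈⟨ ≈-sym (∑-box n h) ⟩
    ∑ (boxEntries n) h                                               ∎
    where open import Algebra.Properties.CommutativeSemigroup +-commutativeSemigroup using (xy∙z≈xz∙y)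

  box-flipOne : ∀ n → BoxSymmetry n flipOne
  box-flipOne zero h = ≈-refl
  box-flipOne (suc m) h = begin
    ∑ (boxEntries (suc m)) (h ∘ flipOne)        ≈⟨ ∑-box (suc m) (h ∘ flipOne) ⟩
    (h (+ 0) + (h -[1+ 0 ] + X)) + (h (+ 1) + Y) ≈⟨ +-congʳ (x∙yz≈y∙xz _ _ _) ⟩
    (h -[1+ 0 ] + (h (+ 0) + X)) + (h (+ 1) + Y) ≈⟨ exchange-heads _ _ _ _ ⟩
    (h (+ 1) + (h (+ 0) + X)) + (h -[1+ 0 ] + Y) ≈⟨ +-congʳ (x∙yz≈y∙xz _ _ _) ⟩
    (h (+ 0) + (h (+ 1) + X)) + (h -[1+ 0 ] + Y) ≈⟨ ≈-sym (∑-box (suc m) h) ⟩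
    ∑ (boxEntries (suc m)) h                     ∎
    where
    X Y : Carrier
    X = ∑< m (λ k → h (+ suc (suc k)))
    Y = ∑< m (λ k → h -[1+ suc k ])
    exchange-heads : ∀ a u b v → (a + u) + (b + v) ≈ (b + u) + (a + v)
    exchange-heads a u b v = ≈-trans (interchange a u b v) (≈-trans (+-congʳ (+-comm a b)) (interchange b a u v))

  ∑-windows-suc : ∀ n k (H : List ℤ → Carrier) →
    ∑ (allWindows n (suc k)) H ≈ ∑ (boxEntries n) (λ a → ∑ (allWindows n k) (λ w → H (a ∷ w)))
  ∑-windows-suc n k H =
    ≈-trans (∑-concatMap (boxEntries n) (λ a → map (a ∷_) (allWindows n k)) H)
            (∑-cong (boxEntries n) (λ a → ≈-reflexive (∑-map (allWindows n k) (a ∷_) H)))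

  ∑-windows-map : ∀ {n φ} → BoxSymmetry n φ → ∀ k (H : List ℤ → Carrier) →
    ∑ (allWindows n k) (H ∘ map φ) ≈ ∑ (allWindows n k) H
  ∑-windows-map symmetry zero H = ≈-refl
  ∑-windows-map {n} {φ} symmetry (suc k) H = begin
    ∑ (allWindows n (suc k)) (H ∘ map φ)
      ≈⟨ ∑-windows-suc n k (H ∘ map φ) ⟩
    ∑ (boxEntries n) (λ a → ∑ (allWindows n k) (λ w → H (φ a ∷ map φ w)))
      ≈⟨ ∑-cong (boxEntries n) (λ a → ∑-windows-map symmetry k (λ w → H (φ a ∷ w))) ⟩
    ∑ (boxEntries n) (λ a → ∑ (allWindows n k) (λ w → H (φ a ∷ w)))
      ≈⟨ symmetry (λ a → ∑ (allWindows n k) (λ w → H (a ∷ w))) ⟩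
    ∑ (boxEntries n) (λ a → ∑ (allWindows n k) (λ w → H (a ∷ w)))
      ≈⟨ ≈-sym (∑-windows-suc n k H) ⟩
    ∑ (allWindows n (suc k)) H ∎

  ∑-windows-onHead : ∀ {n φ} → BoxSymmetry n φ → ∀ k (H : List ℤ → Carrier) →
    ∑ (allWindows n (suc k)) (H ∘ onHead φ) ≈ ∑ (allWindows n (suc k)) H
  ∑-windows-onHead {n} symmetry k H =
    ≈-trans (∑-windows-suc n k (H ∘ onHead _))
            (≈-trans (symmetry (λ a → ∑ (allWindows n k) (λ w → H (a ∷ w))))
                     (≈-sym (∑-windows-suc n k H)))

  ∑-twist : ∀ n k (H : List ℤ → Carrier) → ∑ (allWindows n (suc k)) (H ∘ twist) ≈ ∑ (allWindows n (suc k)) H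
  ∑-twist n k H =
    ≈-trans (∑-windows-map (box-flipOne n) (suc k) (H ∘ onHead -_)) (∑-windows-onHead (box-neg n) k H)

  _^_ : Carrier → ℕ → Carrier
  a ^ k = k times a

  weight : ℕ → Carrier → Carrier → List ℤ → Carrier
  weight n x y w = (y ^ ℓ n w) * (x ^ L n w)

  restricted : ℕ → List ℕ → Carrier → Carrier → List ℤ → Carrier
  restricted n J x y w = if isDn n w then (if inDnJ n J w then weight n x y w else 0#) else 0#

  genSum-as-windowSum : ∀ n J x y → genSum R n J x y ≈ ∑ (allWindows n n) (restricted n J x y)
  genSum-as-windowSum n J x y =
    ≈-trans (≈-reflexive (foldr-as-∑ (DnJ n J) (weight n x y)))
            (∑-filter-T (isDn n) (inDnJ n J) _ _ (allWindows n n) (weight n x y))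

  restricted-twist : ∀ k I → All (λ i → 2 ≤ i × i ≤ suc (suc k) ∸ 1) I → ∀ x y w →
    restricted (suc (suc k)) (1 ∷ I) x y (twist w) ≡ restricted (suc (suc k)) (0 ∷ I) x y w
  restricted-twist k I I⊆ x y w =
    trans (cong (λ b → if b then twisted-summand else 0#) (isDn-twist (suc k) w))
          (if-cong-guarded (isDn n w) on-Dn)
    where
    n : ℕ
    n = suc (suc k)
    twisted-summand : Carrier
    twisted-summand = if inDnJ n (1 ∷ I) (twist w) then weight n x y (twist w) else 0#
    on-Dn : isDn n w ≡ true → twisted-summand ≡ (if inDnJ n (0 ∷ I) w then weight n x y w else 0#)
    on-Dn isDn≡true =
      cong₂ (λ b v → if b then v else 0#) (inDnJ-twist k w σ I I⊆)
            (cong₂ _*_ (cong (y ^_) (ℓ-twist σ)) (cong (x ^_) (L-twist σ)))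
      where
      σ : SignedPermutation n w
      σ = isDn⇒signedPermutation n w isDn≡true

  descent-0-1-symmetry : ∀ k I → All (λ i → 2 ≤ i × i ≤ suc (suc k) ∸ 1) I → ∀ x y →
    genSum R (suc (suc k)) (0 ∷ I) x y ≈ genSum R (suc (suc k)) (1 ∷ I) x y
  descent-0-1-symmetry k I I⊆ x y = begin
    genSum R n (0 ∷ I) x y                              ≈⟨ genSum-as-windowSum n (0 ∷ I) x y ⟩
    ∑ (allWindows n n) (restricted n (0 ∷ I) x y)
      ≈⟨ ∑-cong (allWindows n n) (λ w → ≈-reflexive (sym (restricted-twist k I I⊆ x y w))) ⟩
    ∑ (allWindows n n) (restricted n (1 ∷ I) x y ∘ twist) ≈⟨ ∑-twist n (suc k) (restricted n (1 ∷ I) x y) ⟩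
    ∑ (allWindows n n) (restricted n (1 ∷ I) x y)        ≈⟨ ≈-sym (genSum-as-windowSum n (1 ∷ I) x y) ⟩
    genSum R n (1 ∷ I) x y                              ∎
    where
    n : ℕ
    n = suc (suc k)

proposition3p4 : ∀ {c r : Level} (R : CommutativeRing c r) (n : ℕ) → 2 ≤ n →
    (I : List ℕ) → All (λ i → 2 ≤ i × i ≤ n ∸ 1) I →
    (x y : CommutativeRing.Carrier R) →
    CommutativeRing._≈_ R (genSum R n (0 ∷ I) x y) (genSum R n (1 ∷ I) x y)
      × CommutativeRing._≈_ R (genSum R n (0 ∷ I) x (CommutativeRing.-_ R (CommutativeRing.1# R)))
                              (genSum R n (1 ∷ I) x (CommutativeRing.-_ R (CommutativeRing.1# R)))
proposition3p4 R (suc (suc k)) (s≤s (s≤s z≤n)) I I⊆ x y =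
  descent-0-1-symmetry k I I⊆ x y , descent-0-1-symmetry k I I⊆ x (CommutativeRing.-_ R (CommutativeRing.1# R))
  where open WindowSums R
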